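{- Let $G$ be a graph with maximum degree at least two such that $\gamma_R(G) = 2\beta(G)$. Then (1) $b_R(G) \geq \delta(G)$; (2) $b_R(G) \geq \delta(G) + 1$ if $G$ is a vrc-graph.
   Context: All graphs are finite and simple. A Roman dominating function on $G$ is a function $f: V(G) \to \{0,1,2\}$ such that every vertex $v$ with $f(v)=0$ has a neighbor $u$ with $f(u)=2$; its weight is $\sum_v f(v)$, and $\gamma_R(G)$ is the minimum weight of such a function. The vertex covering number $\beta(G)$ is the minimum number of vertices incident with all edges of $G$. $\delta(G)$ is the minimum degree. For a graph with maximum degree at least two, the Roman bondage number $b_R(G)$ is the minimum cardinality of a set $E' \subseteq E(G)$ with $\gamma_R(G - E') > \gamma_R(G)$, where $G-E'$ is obtained by deleting the edges of $E'$. A graph $G$ is a vrc-graph (vertex Roman domination-critical) if $\gamma_R(G - x) < \gamma_R(G)$ for every vertex $x$ of $G$, where $G - x$ is obtained by deleting $x$ and its incident edges. -}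

module Defs where

open import Data.Nat using (ℕ; _+_; _*_; _≤_; _<_)
open import Data.Nat.ListAction using (sum)
open import Data.Bool using (Bool; true; false; _∧_; _∨_; not; T)
open import Data.Bool.Properties using (∨-comm)
open import Data.Fin using (Fin; punchIn; toℕ; zero; suc)
open import Data.Fin.Properties using () renaming (_≟_ to _≟ᶠ_)
open import Data.List using (List; []; _∷_; length; filter; allFin; map)
open import Data.List.Membership.Propositional using (_∈_)
open import Data.List.Relation.Unary.Any using (any?)
open import Data.List.Relation.Unary.Unique.Propositional using (Unique)
open import Data.Product using (Σ; ∃; _×_; _,_)
open import Data.Sum using (_⊎_)
open import Relation.Nullary using (¬_; Dec; yes; no)
open import Relation.Nullary.Decidable using (⌊_⌋)
open import Relation.Binary.PropositionalEquality using (_≡_; refl; cong; cong₂)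

record Graph (n : ℕ) : Set where
  field
    adj    : Fin n → Fin n → Bool
    sym    : ∀ u v → adj u v ≡ adj v u
    irrefl : ∀ v → adj v v ≡ false
open Graph public

Edge : ∀ {n} → Graph n → Fin n → Fin n → Set
Edge G u v = T (adj G u v)

degree : ∀ {n} → Graph n → Fin n → ℕ
degree G v = length (filter (λ u → T? (adj G v u)) (allFin _))
  where
  T? : (b : Bool) → Dec (T b)
  T? true  = yes _
  T? false = no (λ ())

-- δ(G) = k : k is the minimum degree (n ≥ 1 implicitly, since k must be attained)
IsMinDegree : ∀ {n} → Graph n → ℕ → Set
IsMinDegree G k = (∃ λ v → degree G v ≡ k) × (∀ v → k ≤ degree G v)

MaxDegreeAtLeastTwo : ∀ {n} → Graph n → Set
MaxDegreeAtLeastTwo G = ∃ λ v → 2 ≤ degree G v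

weight : ∀ {n} → (Fin n → Fin 3) → ℕ
weight {n} f = sum (map (λ v → toℕ (f v)) (allFin n))

IsRDF : ∀ {n} → Graph n → (Fin n → Fin 3) → Set
IsRDF G f = ∀ v → f v ≡ zero → ∃ λ u → Edge G v u × f u ≡ suc (suc zero)

IsRomanDomNumber : ∀ {n} → Graph n → ℕ → Set
IsRomanDomNumber G k =
  (∃ λ f → IsRDF G f × weight f ≡ k) × (∀ f → IsRDF G f → k ≤ weight f)

IsVertexCover : ∀ {n} → Graph n → List (Fin n) → Set
IsVertexCover G S = ∀ u v → Edge G u v → u ∈ S ⊎ v ∈ S

IsVertexCoverNumber : ∀ {n} → Graph n → ℕ → Set
IsVertexCoverNumber G k =
  (∃ λ S → Unique S × IsVertexCover G S × length S ≡ k)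
  × (∀ S → Unique S → IsVertexCover G S → k ≤ length S)

-- Edge sets: lists of ordered pairs (u , v), each an edge of G, with no unordered
-- edge listed twice (neither as (u,v),(u,v) nor as (u,v),(v,u)).
SameEdge : ∀ {n} → (Fin n × Fin n) → (Fin n × Fin n) → Set
SameEdge (u , v) (u' , v') = (u ≡ u' × v ≡ v') ⊎ (u ≡ v' × v ≡ u')

data DistinctEdges {n : ℕ} : List (Fin n × Fin n) → Set where
  []  : DistinctEdges []
  _∷_ : ∀ {e es} → (∀ e' → e' ∈ es → ¬ SameEdge e e') → DistinctEdges es → DistinctEdges (e ∷ es)

IsEdgeSet : ∀ {n} → Graph n → List (Fin n × Fin n) → Set
IsEdgeSet G E = (∀ u v → (u , v) ∈ E → Edge G u v) × DistinctEdges E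

listed : ∀ {n} → List (Fin n × Fin n) → Fin n → Fin n → Bool
listed [] u v = false
listed ((a , b) ∷ E) u v = (⌊ a ≟ᶠ u ⌋ ∧ ⌊ b ≟ᶠ v ⌋) ∨ listed E u v

inEdges : ∀ {n} → List (Fin n × Fin n) → Fin n → Fin n → Bool
inEdges E u v = listed E u v ∨ listed E v u

deleteEdges : ∀ {n} → (G : Graph n) → List (Fin n × Fin n) → Graph n
deleteEdges G E = record
  { adj = λ u v → adj G u v ∧ not (inEdges E u v)
  ; sym = λ u v → cong₂ (λ x y → x ∧ not y) (Graph.sym G u v) (∨-comm (listed E u v) (listed E v u))
  ; irrefl = λ v → cong (λ x → x ∧ not (inEdges E v v)) (irrefl G v)
  }

-- G - x for a graph on Fin (suc m): delete vertex x and incident edges;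
-- remaining vertices are re-indexed by Fin m via punchIn x.
deleteVertex : ∀ {m} → Graph (ℕ.suc m) → Fin (ℕ.suc m) → Graph m
deleteVertex G x = record
  { adj = λ u v → adj G (punchIn x u) (punchIn x v)
  ; sym = λ u v → Graph.sym G (punchIn x u) (punchIn x v)
  ; irrefl = λ v → irrefl G (punchIn x v)
  }

IsVRC : ∀ {m} → Graph (ℕ.suc m) → Set
IsVRC G = ∀ x k k' → IsRomanDomNumber G k → IsRomanDomNumber (deleteVertex G x) k' → k' < k

RomanBondageAtLeast : ∀ {n} → Graph n → ℕ → Set
RomanBondageAtLeast G k =
  ∀ E → IsEdgeSet G E → length E < k →
  ∀ g g' → IsRomanDomNumber G g → IsRomanDomNumber (deleteEdges G E) g' → ¬ (g < g')

-- Removing fewer than δ edges leaves no vertex isolated, so doubling a minimum vertex cover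
-- is still a Roman dominating function and γ_R(G − E) ≤ 2β(G) = γ_R(G). Removing exactly δ
-- edges can isolate a vertex v only if every removed edge is incident with v; then a
-- minimum Roman dominating function of G − v, extended by the value 1 at v, dominates
-- G − E, and for a vrc-graph its weight γ_R(G − v) + 1 is at most γ_R(G).
module Submission where

open import Defs hiding (sym)
open import Data.Empty using (⊥-elim)
open import Data.Bool using (true; false; not; T)
open import Data.Bool.Properties using (T-∧; T-∨)
open import Data.Fin using (Fin; zero; suc; toℕ; punchIn; punchOut; finToFun; funToFin)
open import Data.Fin.Properties
  using (any?; all?; ¬∀⟶∃¬; punchInᵢ≢i; punchIn-punchOut; finToFun-funToFin)
  renaming (_≟_ to _≟ᶠ_)
open import Data.List using (List; []; _∷_; length; filter; allFin; map; tabulate)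
open import Data.List.Extrema.Nat using (argmin; argmin-all; f[argmin]≤f[xs])
open import Data.List.Membership.Propositional using (_∈_)
open import Data.List.Membership.Propositional.Properties
  using (∈-map⁺; ∈-filter⁺; ∈-filter⁻; ∈-allFin)
open import Data.List.Properties
  using (length-map; length-filter; filter-notAll; map-tabulate; map-cong; length-removeAt′)
open import Data.List.Relation.Unary.All as All using (All)
open import Data.List.Relation.Unary.All.Properties using (¬All⇒Any¬)
open import Data.List.Relation.Unary.AllPairs using (_∷_)
open import Data.List.Relation.Unary.Any as Any using (here; there; _─_)
open import Data.List.Relation.Unary.Unique.Propositional using (Unique)
open import Data.List.Relation.Unary.Unique.Propositional.Properties using (allFin⁺; filter⁺)
open import Data.Nat using (ℕ; suc; _+_; _*_; _^_; _≤_; _<_; z≤n; s≤s)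
open import Data.Nat.ListAction using (sum)
open import Data.Nat.Properties
open import Algebra.Properties.CommutativeMonoid.Sum +-0-commutativeMonoid
  using (sum-remove; sum-cong-≗) renaming (sum to ∑)
open import Data.Product using (∃; _×_; _,_; proj₁; proj₂)
open import Data.Sum using (_⊎_; inj₁; inj₂; [_,_])
open import Data.Vec.Functional using (insertAt)
open import Data.Vec.Functional.Properties using (insertAt-lookup; insertAt-punchIn; removeAt-insertAt)
open import Function using (_∘_)
open import Function.Bundles using (Equivalence)
open import Relation.Nullary using (¬_; Dec; yes; no)
open import Relation.Nullary.Decidable using (_×-dec_; _⊎-dec_; _→-dec_; T?)
open import Relation.Binary.PropositionalEquality
  using (_≡_; _≢_; refl; cong; cong₂; sym; trans; subst; _≗_; module ≡-Reasoning)

open Equivalence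

∈-─ : ∀ {A : Set} {x y : A} {ys} (x∈ys : x ∈ ys) → y ∈ ys → y ≢ x → y ∈ (ys ─ x∈ys)
∈-─ (here refl) (here refl) y≢x = ⊥-elim (y≢x refl)
∈-─ (here _)    (there y∈ys) _  = y∈ys
∈-─ (there _)   (here refl) _   = here refl
∈-─ (there x∈ys) (there y∈ys) y≢x = there (∈-─ x∈ys y∈ys y≢x)

Unique-⊆⇒length≤ : ∀ {A : Set} {xs ys : List A} →
                   Unique xs → (∀ {z} → z ∈ xs → z ∈ ys) → length xs ≤ length ys
Unique-⊆⇒length≤ {xs = []} _ _ = z≤n
Unique-⊆⇒length≤ {xs = x ∷ xs} {ys} (x∉xs ∷ uxs) xs⊆ys =
  subst (suc (length xs) ≤_) (sym (length-removeAt′ ys _)) (s≤s (Unique-⊆⇒length≤ uxs xs⊆ys─x))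
  where
  x∈ys : x ∈ ys
  x∈ys = xs⊆ys (here refl)
  xs⊆ys─x : ∀ {z} → z ∈ xs → z ∈ (ys ─ x∈ys)
  xs⊆ys─x z∈xs = ∈-─ x∈ys (xs⊆ys (there z∈xs)) (λ z≡x → All.lookup x∉xs z∈xs (sym z≡x))

sum-tabulate : ∀ {n} (g : Fin n → ℕ) → sum (tabulate g) ≡ ∑ g
sum-tabulate {ℕ.zero} g = refl
sum-tabulate {suc n}  g = cong (g zero +_) (sum-tabulate (g ∘ suc))

weight≡∑ : ∀ {n} (f : Fin n → Fin 3) → weight f ≡ ∑ (toℕ ∘ f)
weight≡∑ f = trans (cong sum (map-tabulate (λ v → v) (toℕ ∘ f))) (sum-tabulate (toℕ ∘ f))

weight-cong : ∀ {n} {f g : Fin n → Fin 3} → f ≗ g → weight f ≡ weight g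
weight-cong {n} f≗g = cong sum (map-cong (cong toℕ ∘ f≗g) (allFin n))

weight-insertAt : ∀ {m} (h : Fin m → Fin 3) v c → weight (insertAt h v c) ≡ toℕ c + weight h
weight-insertAt h v c = begin
  weight (insertAt h v c)                          ≡⟨ weight≡∑ (insertAt h v c) ⟩
  ∑ (toℕ ∘ insertAt h v c)                         ≡⟨ sum-remove {i = v} (toℕ ∘ insertAt h v c) ⟩
  toℕ (insertAt h v c v) + ∑ (toℕ ∘ insertAt h v c ∘ punchIn v)
    ≡⟨ cong₂ _+_ (cong toℕ (insertAt-lookup h v c)) (sum-cong-≗ (cong toℕ ∘ removeAt-insertAt h v c)) ⟩
  toℕ c + ∑ (toℕ ∘ h)                              ≡⟨ cong (toℕ c +_) (weight≡∑ h) ⟨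
  toℕ c + weight h                                 ∎
  where open ≡-Reasoning

module _ {n} (G : Graph n) where

  IsRDF-resp-≗ : ∀ {f g} → f ≗ g → IsRDF G f → IsRDF G g
  IsRDF-resp-≗ f≗g rdf v gv≡0 with rdf v (trans (f≗g v) gv≡0)
  ... | u , v~u , fu≡2 = u , v~u , trans (sym (f≗g u)) fu≡2

  isRDF? : ∀ f → Dec (IsRDF G f)
  isRDF? f = all? λ v → (f v ≟ᶠ zero) →-dec any? λ u → T? (adj G v u) ×-dec (f u ≟ᶠ suc (suc zero))

  romanDomNumber-unique : ∀ {k k'} → IsRomanDomNumber G k → IsRomanDomNumber G k' → k ≡ k'
  romanDomNumber-unique ((f , rdf , refl) , min) ((f' , rdf' , refl) , min') =
    ≤-antisym (min f' rdf') (min' f rdf)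

  romanDomNumber-exists : ∃ (IsRomanDomNumber G)
  romanDomNumber-exists = weight f₀ , (f₀ , rdf₀ , refl) , minimal
    where
    functions : List (Fin n → Fin 3)
    functions = map finToFun (allFin (3 ^ n))

    candidates : List (Fin n → Fin 3)
    candidates = filter isRDF? functions

    f₀ : Fin n → Fin 3
    f₀ = argmin weight (λ _ → suc zero) candidates

    rdf₀ : IsRDF G f₀
    rdf₀ = argmin-all weight {xs = candidates} (λ _ ())
      (All.tabulate (proj₂ ∘ ∈-filter⁻ isRDF? {xs = functions}))

    minimal : ∀ f → IsRDF G f → weight f₀ ≤ weight f
    minimal f rdf = subst (weight f₀ ≤_) (weight-cong (finToFun-funToFin f))
      (All.lookup (f[argmin]≤f[xs] {f = weight} (λ _ → suc zero) candidates)
        (∈-filter⁺ isRDF? (∈-map⁺ finToFun (∈-allFin (funToFin f)))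
          (IsRDF-resp-≗ (sym ∘ finToFun-funToFin f) rdf)))

Isolated : ∀ {n} → Graph n → Fin n → Set
Isolated H v = ¬ ∃ (Edge H v)

isolated-or-noIsolated : ∀ {n} (H : Graph n) → ∃ (Isolated H) ⊎ (∀ v → ∃ (Edge H v))
isolated-or-noIsolated H with all? (λ v → any? (T? ∘ adj H v))
... | yes noIsolated = inj₂ noIsolated
... | no ¬noIsolated = inj₁ (¬∀⟶∃¬ _ _ (λ v → any? (T? ∘ adj H v)) ¬noIsolated)

neighbours⊆⇒degree≤ : ∀ {n} (G : Graph n) v {xs} → (∀ {u} → Edge G v u → u ∈ xs) → degree G v ≤ length xs
neighbours⊆⇒degree≤ {n} G v ⊆xs =
  Unique-⊆⇒length≤ (filter⁺ _ (allFin⁺ n)) (⊆xs ∘ proj₂ ∘ ∈-filter⁻ _ {xs = allFin n})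

¬T⇒T-not : ∀ {x} → ¬ T x → T (not x)
¬T⇒T-not {true}  ¬t = ¬t _
¬T⇒T-not {false} _  = _

listed⇒∈ : ∀ {n} (E : List (Fin n × Fin n)) {a b} → T (listed E a b) → (a , b) ∈ E
listed⇒∈ ((x , y) ∷ E) {a} {b} t with x ≟ᶠ a | y ≟ᶠ b
... | yes refl | yes refl = here refl
... | yes _    | no _     = there (listed⇒∈ E t)
... | no _     | _        = there (listed⇒∈ E t)

inEdges⇒∈ : ∀ {n} (E : List (Fin n × Fin n)) {a b} →
            T (inEdges E a b) → (a , b) ∈ E ⊎ (b , a) ∈ E
inEdges⇒∈ E t with T-∨ .to t
... | inj₁ ab = inj₁ (listed⇒∈ E ab)
... | inj₂ ba = inj₂ (listed⇒∈ E ba)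

Touches : ∀ {n} → Fin n → Fin n × Fin n → Set
Touches v (a , b) = a ≡ v ⊎ b ≡ v

touches? : ∀ {n} (v : Fin n) e → Dec (Touches v e)
touches? v (a , b) = (a ≟ᶠ v) ⊎-dec (b ≟ᶠ v)

otherEnd : ∀ {n} → Fin n → Fin n × Fin n → Fin n
otherEnd v (a , b) with a ≟ᶠ v
... | yes _ = b
... | no _  = a

otherEnd-from : ∀ {n} (v u : Fin n) → otherEnd v (v , u) ≡ u
otherEnd-from v u with v ≟ᶠ v
... | yes _   = refl
... | no v≢v  = ⊥-elim (v≢v refl)

otherEnd-to : ∀ {n} {v u : Fin n} → u ≢ v → otherEnd v (u , v) ≡ u
otherEnd-to {v = v} {u} u≢v with u ≟ᶠ v
... | yes u≡v = ⊥-elim (u≢v u≡v)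
... | no _    = refl

module _ {n} (G : Graph n) (E : List (Fin n × Fin n)) where

  edge-kept : ∀ {a b} → Edge G a b → ¬ T (inEdges E a b) → Edge (deleteEdges G E) a b
  edge-kept a~b ¬del = T-∧ .from (a~b , ¬T⇒T-not ¬del)

  edge-deleted : ∀ {a b} → Edge G a b → ¬ Edge (deleteEdges G E) a b → T (inEdges E a b)
  edge-deleted {a} {b} a~b ¬a~b with T? (inEdges E a b)
  ... | yes del = del
  ... | no ¬del = ⊥-elim (¬a~b (edge-kept a~b ¬del))

  deleteEdges-⊆ : ∀ {a b} → Edge (deleteEdges G E) a b → Edge G a b
  deleteEdges-⊆ = proj₁ ∘ T-∧ .to

  deleteEdges-cover : ∀ {S} → IsVertexCover G S → IsVertexCover (deleteEdges G E) S
  deleteEdges-cover cover u v = cover u v ∘ deleteEdges-⊆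

  isolated⇒degree≤incident : ∀ {v} → Isolated (deleteEdges G E) v →
                             degree G v ≤ length (filter (touches? v) E)
  isolated⇒degree≤incident {v} iso =
    subst (degree G v ≤_) (length-map (otherEnd v) (filter (touches? v) E))
      (neighbours⊆⇒degree≤ G v lost)
    where
    lost : ∀ {u} → Edge G v u → u ∈ map (otherEnd v) (filter (touches? v) E)
    lost {u} v~u with inEdges⇒∈ E (edge-deleted v~u (λ v~'u → iso (u , v~'u)))
    ... | inj₁ vu∈E = subst (_∈ _) (otherEnd-from v u) (∈-map⁺ _ (∈-filter⁺ _ vu∈E (inj₁ refl)))
    ... | inj₂ uv∈E = subst (_∈ _) (otherEnd-to u≢v) (∈-map⁺ _ (∈-filter⁺ _ uv∈E (inj₂ refl)))
      where
      u≢v : u ≢ v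
      u≢v refl = subst T (irrefl G v) v~u

  length<degree⇒¬isolated : ∀ {v} → length E < degree G v → ¬ Isolated (deleteEdges G E) v
  length<degree⇒¬isolated ∣E∣<deg iso =
    <⇒≱ ∣E∣<deg (≤-trans (isolated⇒degree≤incident iso) (length-filter (touches? _) E))

  isolated⇒allTouch : ∀ {v} → Isolated (deleteEdges G E) v → length E ≤ degree G v →
                      All (Touches v) E
  isolated⇒allTouch {v} iso ∣E∣≤deg with All.all? (touches? v) E
  ... | yes allTouch = allTouch
  ... | no ¬allTouch = ⊥-elim (<⇒≱
    (<-≤-trans (filter-notAll (touches? v) E (¬All⇒Any¬ (touches? v) E ¬allTouch)) ∣E∣≤deg)
    (isolated⇒degree≤incident iso))

  avoiding-edge-kept : ∀ {v a b} → All (Touches v) E → Edge G a b → a ≢ v → b ≢ v →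
                       Edge (deleteEdges G E) a b
  avoiding-edge-kept {v} allTouch a~b a≢v b≢v =
    edge-kept a~b λ del → [ avoided a≢v b≢v , avoided b≢v a≢v ] (inEdges⇒∈ E del)
    where
    avoided : ∀ {x y} → x ≢ v → y ≢ v → ¬ (x , y) ∈ E
    avoided x≢v y≢v xy∈E = [ x≢v , y≢v ] (All.lookup allTouch xy∈E)

_∈?_ : ∀ {n} (v : Fin n) (S : List (Fin n)) → Dec (v ∈ S)
v ∈? S = Any.any? (v ≟ᶠ_) S

twiceIndicator : ∀ {n} → List (Fin n) → Fin n → Fin 3
twiceIndicator S v with v ∈? S
... | yes _ = suc (suc zero)
... | no _  = zero

twiceIndicator-∈ : ∀ {n} {S : List (Fin n)} {v} → v ∈ S → twiceIndicator S v ≡ suc (suc zero)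
twiceIndicator-∈ {S = S} {v} v∈S with v ∈? S
... | yes _   = refl
... | no v∉S  = ⊥-elim (v∉S v∈S)

sum-twiceIndicator : ∀ {n} (S L : List (Fin n)) →
                     sum (map (toℕ ∘ twiceIndicator S) L) ≡ 2 * length (filter (_∈? S) L)
sum-twiceIndicator S [] = refl
sum-twiceIndicator S (v ∷ L) with v ∈? S
... | yes _ = trans (cong (2 +_) (sum-twiceIndicator S L)) (sym (*-suc 2 _))
... | no _  = sum-twiceIndicator S L

weight-twiceIndicator : ∀ {n} (S : List (Fin n)) → weight (twiceIndicator S) ≤ 2 * length S
weight-twiceIndicator {n} S =
  subst (_≤ 2 * length S) (sym (sum-twiceIndicator S (allFin n)))
    (*-monoʳ-≤ 2 (Unique-⊆⇒length≤ (filter⁺ (_∈? S) (allFin⁺ n))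
                                    (proj₂ ∘ ∈-filter⁻ (_∈? S) {xs = allFin n})))

module _ {n} (H : Graph n) where

  cover⇒twiceIndicator-RDF : ∀ {S} → (∀ v → ∃ (Edge H v)) → IsVertexCover H S →
                             IsRDF H (twiceIndicator S)
  cover⇒twiceIndicator-RDF {S} noIsolated cover v fv≡0 with noIsolated v
  ... | u , v~u with cover v u v~u
  ...   | inj₂ u∈S = u , v~u , twiceIndicator-∈ u∈S
  ...   | inj₁ v∈S with trans (sym (twiceIndicator-∈ v∈S)) fv≡0
  ...     | ()

  noIsolated⇒γR≤2∣cover∣ : ∀ {S k} → (∀ v → ∃ (Edge H v)) → IsVertexCover H S →
                          IsRomanDomNumber H k → k ≤ 2 * length S
  noIsolated⇒γR≤2∣cover∣ {S} noIsolated cover (_ , minimal) =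
    ≤-trans (minimal _ (cover⇒twiceIndicator-RDF noIsolated cover)) (weight-twiceIndicator S)

punchIn-or-self : ∀ {m} (v w : Fin (suc m)) → v ≡ w ⊎ ∃ λ u → punchIn v u ≡ w
punchIn-or-self v w with v ≟ᶠ w
... | yes v≡w = inj₁ v≡w
... | no v≢w  = inj₂ (punchOut v≢w , punchIn-punchOut v≢w)

punchIn-⊆⇒γR≤suc : ∀ {m} (H : Graph (suc m)) (K : Graph m) v {k k'} →
                    (∀ {a b} → Edge K a b → Edge H (punchIn v a) (punchIn v b)) →
                    IsRomanDomNumber H k → IsRomanDomNumber K k' → k ≤ suc k'
punchIn-⊆⇒γR≤suc {m} H K v {k} K⊆H (_ , minimal) ((h , rdf , refl) , _) =
  subst (k ≤_) (weight-insertAt h v (suc zero)) (minimal F rdf')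
  where
  F : Fin (suc m) → Fin 3
  F = insertAt h v (suc zero)
  rdf' : IsRDF H F
  rdf' w Fw≡0 with punchIn-or-self v w
  ... | inj₁ refl with trans (sym (insertAt-lookup h v (suc zero))) Fw≡0
  ...   | ()
  rdf' w Fw≡0 | inj₂ (u , refl) with rdf u (trans (sym (insertAt-punchIn h v (suc zero) u)) Fw≡0)
  ...   | u' , u~u' , hu'≡2 = punchIn v u' , K⊆H u~u' , trans (insertAt-punchIn h v (suc zero) u') hu'≡2

theorem9 : ∀ {m} (G : Graph (suc m)) (g b d : ℕ) →
    MaxDegreeAtLeastTwo G →
    IsRomanDomNumber G g → IsVertexCoverNumber G b → g ≡ 2 * b →
    IsMinDegree G d →
    RomanBondageAtLeast G d × (IsVRC G → RomanBondageAtLeast G (d + 1))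
theorem9 G g b d _ γR ((S , _ , S-covers , ∣S∣≡b) , _) g≡2b (_ , δ≤deg) = bondage≥δ , bondage≥δ+1
  where
  noIsolated⇒notIncreased : ∀ E {g₁ g'} → (∀ v → ∃ (Edge (deleteEdges G E) v)) →
                            IsRomanDomNumber G g₁ → IsRomanDomNumber (deleteEdges G E) g' → ¬ g₁ < g'
  noIsolated⇒notIncreased E {g₁} {g'} noIsolated γR₁ γR' = ≤⇒≯ (begin
    g'           ≤⟨ noIsolated⇒γR≤2∣cover∣ (deleteEdges G E) noIsolated (deleteEdges-cover G E S-covers) γR' ⟩
    2 * length S ≡⟨ cong (2 *_) ∣S∣≡b ⟩
    2 * b        ≡⟨ g≡2b ⟨
    g            ≡⟨ romanDomNumber-unique G γR γR₁ ⟩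
    g₁           ∎)
    where open ≤-Reasoning

  bondage≥δ : RomanBondageAtLeast G d
  bondage≥δ E _ ∣E∣<d g₁ g' γR₁ γR' with isolated-or-noIsolated (deleteEdges G E)
  ... | inj₁ (v , iso)  = ⊥-elim (length<degree⇒¬isolated G E (<-≤-trans ∣E∣<d (δ≤deg v)) iso)
  ... | inj₂ noIsolated = noIsolated⇒notIncreased E noIsolated γR₁ γR'

  bondage≥δ+1 : IsVRC G → RomanBondageAtLeast G (d + 1)
  bondage≥δ+1 vrc E _ ∣E∣<d+1 g₁ g' γR₁ γR' with isolated-or-noIsolated (deleteEdges G E)
  ... | inj₂ noIsolated = noIsolated⇒notIncreased E noIsolated γR₁ γR'
  ... | inj₁ (v , iso)  with romanDomNumber-exists (deleteVertex G v)
  ...   | k , γR[G−v] = ≤⇒≯ (begin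
    g'    ≤⟨ punchIn-⊆⇒γR≤suc (deleteEdges G E) (deleteVertex G v) v kept γR' γR[G−v] ⟩
    suc k ≤⟨ vrc v g₁ k γR₁ γR[G−v] ⟩
    g₁    ∎)
    where
    open ≤-Reasoning

    ∣E∣≤d : length E ≤ d
    ∣E∣≤d = m<1+n⇒m≤n (subst (length E <_) (+-comm d 1) ∣E∣<d+1)

    allTouch : All (Touches v) E
    allTouch = isolated⇒allTouch G E iso (≤-trans ∣E∣≤d (δ≤deg v))

    kept : ∀ {a b} → Edge (deleteVertex G v) a b → Edge (deleteEdges G E) (punchIn v a) (punchIn v b)
    kept {a} {b} a~b = avoiding-edge-kept G E allTouch a~b (punchInᵢ≢i v a) (punchInᵢ≢i v b)
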